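{- For every nonnegative integer $g$, $\#\mathcal{S}(4,g)\le\#\mathcal{S}(4,g+1)$, where $\mathcal{S}(4,g)$ denotes the set of numerical semigroups with multiplicity four and genus $g$.
   Context: A numerical semigroup is a submonoid $S$ of $(\mathbb{N},+)$ with $\mathbb{N}\setminus S$ finite. Its multiplicity is its least positive element and its genus is $\#(\mathbb{N}\setminus S)$. -}

module Defs where

open import Data.Nat using (ℕ; zero; suc; _+_; _≤_; _<_)
open import Data.Bool using (Bool; true; false)
open import Data.List using (List; length)
open import Data.List.Membership.Propositional using (_∈_)
open import Data.List.Relation.Unary.Unique.Propositional using (Unique)
open import Data.Product using (Σ; ∃; _×_; proj₁)
open import Function.Bundles using (_⇔_)
open import Relation.Binary.PropositionalEquality using (_≡_)

-- Subsets are given by (decidable) characteristic functions ℕ → Bool;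
-- every numerical semigroup is decidable since its complement is finite.
record NumericalSemigroup : Set where
  field
    mem      : ℕ → Bool
    zero∈    : mem 0 ≡ true
    closed   : ∀ a b → mem a ≡ true → mem b ≡ true → mem (a + b) ≡ true
    cofinite : ∃ λ N → ∀ n → N ≤ n → mem n ≡ true

open NumericalSemigroup public

HasMultiplicity : NumericalSemigroup → ℕ → Set
HasMultiplicity S m = 0 < m × mem S m ≡ true × (∀ n → 0 < n → n < m → mem S n ≡ false)

HasGenus : NumericalSemigroup → ℕ → Set
HasGenus S g = Σ (List ℕ) λ gs → Unique gs × length gs ≡ g × (∀ n → (n ∈ gs) ⇔ (mem S n ≡ false))

-- 𝒮(m,g): numerical semigroups with multiplicity m and genus g
-- (carrying proof data; compared via the equivalence _≈S_ below).
𝒮 : ℕ → ℕ → Set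
𝒮 m g = Σ NumericalSemigroup λ S → HasMultiplicity S m × HasGenus S g

_≈S_ : ∀ {m g} → 𝒮 m g → 𝒮 m g → Set
x ≈S y = ∀ n → mem (proj₁ x) n ≡ mem (proj₁ y) n

-- #𝒮(m,g) ≤ #𝒮(m',g'): there is a well-defined injective map A → B
-- (with respect to equality of semigroups as subsets of ℕ).
#𝒮≤#𝒮 : ℕ → ℕ → ℕ → ℕ → Set
#𝒮≤#𝒮 m g m' g' =
  Σ (𝒮 m g → 𝒮 m' g') λ f →
    (∀ x y → x ≈S y → f x ≈S f y) × (∀ x y → f x ≈S f y → x ≈S y)

module Submission where

-- Let S be a numerical semigroup of
-- multiplicity 4.  Since 4 ∈ S, every residue class r mod 4 meets S in
-- a "threshold set" {q * 4 + r ∣ k_r ≤ q}; k₀ = 0, and the Kunz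
-- coordinates (k₁ , k₂ , k₃) determine S.  The gaps of S are the
-- q * 4 + r with q < k_r, so the genus of S is k₁ + k₂ + k₃.
-- Closure of S under addition is equivalent to the carry inequalities
--   k_{(i+j) mod 4} ≤ k_i + k_j + ⌊(i+j)/4⌋,
-- which for multiplicity 4 reduce to the four inequalities of the
-- record Kunz below; together with k_r ≥ 1 they describe exactly the
-- semigroups of multiplicity 4.  Hence 𝒮(4,g) corresponds to the Kunz
-- triples of weight g.  The map
--   φ(a,b,c) = (a+1,b,c) if a ≤ b + c,   (c+1,b,a) otherwise
-- sends Kunz triples to Kunz triples, raises the weight by one and is
-- injective on Kunz triples (the inequality c ≤ a + b separates the
-- images of the two branches); transporting it gives 𝒮(4,g) ↪ 𝒮(4,g+1).

open import Defs
open import Data.Nat using (ℕ; suc)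

open import Data.Nat using (zero; _+_; _*_; _≤_; _<_; _≤′_; _≤ᵇ_; z≤n; s≤s; ≤′-refl; ≤′-step)
open import Data.Nat.Properties
open import Data.Nat.Tactic.RingSolver using (solve-∀)
open import Data.Bool using (Bool; true; false; if_then_else_)
open import Data.Bool.Properties using (T-≡; ¬-not; not-¬)
open import Data.Empty using (⊥-elim)
open import Data.Product using (∃; _×_; _,_; proj₁; proj₂)
open import Data.Sum using (inj₁; inj₂)
open import Data.List using (List; length; _++_; applyUpTo)
open import Data.List.Properties using (length-++; length-applyUpTo)
open import Data.List.Membership.Propositional using (_∈_)
open import Data.List.Membership.Propositional.Properties using (∈-++⁺ˡ; ∈-++⁺ʳ; ∈-++⁻; ∈-applyUpTo⁺; ∈-applyUpTo⁻)
open import Data.List.Membership.Propositional.Properties.WithK using (unique∧set⇒bag)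
open import Data.List.Relation.Binary.BagAndSetEquality using (∼bag⇒↭)
open import Data.List.Relation.Binary.Permutation.Propositional.Properties using (↭-length)
open import Data.List.Relation.Binary.Disjoint.Propositional using (Disjoint)
open import Data.List.Relation.Unary.Unique.Propositional using (Unique)
open import Data.List.Relation.Unary.Unique.Propositional.Properties using (++⁺; applyUpTo⁺₁)
open import Function.Bundles using (_⇔_; mk⇔; Equivalence)
open import Relation.Nullary using (yes; no)
open import Relation.Binary.PropositionalEquality

quot4 : ℕ → ℕ
quot4 (suc (suc (suc (suc n)))) = suc (quot4 n)
quot4 _ = 0

rem4 : ℕ → ℕ
rem4 (suc (suc (suc (suc n)))) = rem4 n
rem4 n = n

-- The possible remainders, as a view that lets definitions compute.
data Residue4 : ℕ → Set where
  r0 : Residue4 0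
  r1 : Residue4 1
  r2 : Residue4 2
  r3 : Residue4 3

quot4-rem4 : ∀ n → quot4 n * 4 + rem4 n ≡ n
quot4-rem4 0 = refl
quot4-rem4 1 = refl
quot4-rem4 2 = refl
quot4-rem4 3 = refl
quot4-rem4 (suc (suc (suc (suc n)))) = cong (4 +_) (quot4-rem4 n)

rem4-residue : ∀ n → Residue4 (rem4 n)
rem4-residue 0 = r0
rem4-residue 1 = r1
rem4-residue 2 = r2
rem4-residue 3 = r3
rem4-residue (suc (suc (suc (suc n)))) = rem4-residue n

quot4-unique : ∀ q {r} → Residue4 r → quot4 (q * 4 + r) ≡ q
quot4-unique zero r0 = refl
quot4-unique zero r1 = refl
quot4-unique zero r2 = refl
quot4-unique zero r3 = refl
quot4-unique (suc q) rr = cong suc (quot4-unique q rr)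

rem4-unique : ∀ q {r} → Residue4 r → rem4 (q * 4 + r) ≡ r
rem4-unique zero r0 = refl
rem4-unique zero r1 = refl
rem4-unique zero r2 = refl
rem4-unique zero r3 = refl
rem4-unique (suc q) rr = rem4-unique q rr

quot4-lower : ∀ M n → M * 4 ≤ n → M ≤ quot4 n
quot4-lower zero n _ = z≤n
quot4-lower (suc M) (suc (suc (suc (suc n)))) (s≤s (s≤s (s≤s (s≤s h)))) = s≤s (quot4-lower M n h)

split-sum : ∀ p q i j → (p * 4 + i) + (q * 4 + j) ≡ (p + q + quot4 (i + j)) * 4 + rem4 (i + j)
split-sum p q i j = begin
  (p * 4 + i) + (q * 4 + j)                    ≡⟨ regroup p q i j ⟩
  (p + q) * 4 + (i + j)                        ≡⟨ cong ((p + q) * 4 +_) (sym (quot4-rem4 (i + j))) ⟩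
  (p + q) * 4 + (quot4 (i + j) * 4 + rem4 (i + j)) ≡⟨ carry (p + q) (quot4 (i + j)) (rem4 (i + j)) ⟩
  (p + q + quot4 (i + j)) * 4 + rem4 (i + j)   ∎
  where
  open ≡-Reasoning
  regroup : ∀ p q i j → (p * 4 + i) + (q * 4 + j) ≡ (p + q) * 4 + (i + j)
  regroup = solve-∀
  carry : ∀ s c r → s * 4 + (c * 4 + r) ≡ (s + c) * 4 + r
  carry = solve-∀

≤ᵇ-true : ∀ {m n} → m ≤ n → (m ≤ᵇ n) ≡ true
≤ᵇ-true h = Equivalence.to T-≡ (≤⇒≤ᵇ h)

≤ᵇ-true⁻¹ : ∀ {m n} → (m ≤ᵇ n) ≡ true → m ≤ n
≤ᵇ-true⁻¹ {m} {n} e = ≤ᵇ⇒≤ m n (Equivalence.from T-≡ e)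

≤ᵇ-false : ∀ {m n} → n < m → (m ≤ᵇ n) ≡ false
≤ᵇ-false n<m = ¬-not (λ e → <⇒≱ n<m (≤ᵇ-true⁻¹ e))

≤ᵇ-false⁻¹ : ∀ {m n} → (m ≤ᵇ n) ≡ false → n < m
≤ᵇ-false⁻¹ e = ≰⇒> (λ m≤n → not-¬ e (≤ᵇ-true m≤n))

≤ᵇ-injective : ∀ {k k′} → (∀ q → (k ≤ᵇ q) ≡ (k′ ≤ᵇ q)) → k ≡ k′
≤ᵇ-injective {k} {k′} same =
  ≤-antisym (≤ᵇ-true⁻¹ (trans (same k′) (≤ᵇ-true (≤-refl {k′}))))
            (≤ᵇ-true⁻¹ (trans (sym (same k)) (≤ᵇ-true (≤-refl {k}))))

least : (P : ℕ → Bool) → ∀ N → P N ≡ true → ∃ λ k → P k ≡ true × (∀ j → j < k → P j ≡ false)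
least P zero h = 0 , h , λ _ ()
least P (suc N) h with P 0 in P0
... | true = 0 , P0 , λ _ ()
... | false with least (λ n → P (suc n)) N h
...   | k , Pk , below = suc k , Pk , λ { zero _ → P0 ; (suc j) (s≤s j<k) → below j j<k }

unique-length : ∀ {A : Set} {xs ys : List A} → Unique xs → Unique ys → (∀ {n} → (n ∈ xs) ⇔ (n ∈ ys)) →
                length xs ≡ length ys
unique-length ux uy same = ↭-length (∼bag⇒↭ (unique∧set⇒bag ux uy same))

-- Candidate Kunz coordinates: thresholds of the residue classes 1, 2, 3.
record Triple : Set where
  constructor ⟨_,_,_⟩
  field
    k₁ k₂ k₃ : ℕ

open Triple

coord : Triple → ℕ → ℕ
coord t 1 = k₁ t
coord t 2 = k₂ t
coord t 3 = k₃ t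
coord t _ = 0

-- The weight is the number of gaps of the threshold set (gapList-length).
weight : Triple → ℕ
weight t = k₁ t + (k₂ t + k₃ t)

coord≤weight : ∀ t r → coord t r ≤ weight t
coord≤weight t 1 = m≤m+n (k₁ t) _
coord≤weight t 2 = ≤-trans (m≤m+n (k₂ t) (k₃ t)) (m≤n+m _ (k₁ t))
coord≤weight t 3 = ≤-trans (m≤n+m (k₃ t) (k₂ t)) (m≤n+m _ (k₁ t))
coord≤weight t 0 = z≤n
coord≤weight t (suc (suc (suc (suc _)))) = z≤n

memK : Triple → ℕ → Bool
memK t n = coord t (rem4 n) ≤ᵇ quot4 n

memK-spec : ∀ t q {r} → Residue4 r → memK t (q * 4 + r) ≡ (coord t r ≤ᵇ q)
memK-spec t q rr rewrite quot4-unique q rr | rem4-unique q rr = refl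

memK-coord : ∀ {t t′} → (∀ n → memK t n ≡ memK t′ n) → ∀ {r} → Residue4 r → coord t r ≡ coord t′ r
memK-coord {t} {t′} same {r} rr = ≤ᵇ-injective λ q →
  trans (sym (memK-spec t q rr)) (trans (same (q * 4 + r)) (memK-spec t′ q rr))

memK-injective : ∀ {t t′} → (∀ n → memK t n ≡ memK t′ n) → t ≡ t′
memK-injective same with memK-coord same r1 | memK-coord same r2 | memK-coord same r3
... | refl | refl | refl = refl

AdditivelyClosed : (ℕ → Bool) → Set
AdditivelyClosed P = ∀ a b → P a ≡ true → P b ≡ true → P (a + b) ≡ true

-- The carry inequalities: adding the least elements of classes i and j.
CarryInequality : Triple → Set
CarryInequality t = ∀ {i j} → Residue4 i → Residue4 j →
  coord t (rem4 (i + j)) ≤ coord t i + coord t j + quot4 (i + j)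

carry⇒closed : ∀ t → CarryInequality t → AdditivelyClosed (memK t)
carry⇒closed t carry x y hx hy =
  subst (λ n → memK t n ≡ true) split
    (trans (memK-spec t _ (rem4-residue (i + j))) (≤ᵇ-true bound))
  where
  p i q j : ℕ
  p = quot4 x
  i = rem4 x
  q = quot4 y
  j = rem4 y
  split : (p + q + quot4 (i + j)) * 4 + rem4 (i + j) ≡ x + y
  split = trans (sym (split-sum p q i j)) (cong₂ _+_ (quot4-rem4 x) (quot4-rem4 y))
  bound : coord t (rem4 (i + j)) ≤ p + q + quot4 (i + j)
  bound = ≤-trans (carry (rem4-residue x) (rem4-residue y))
                  (+-monoˡ-≤ (quot4 (i + j)) (+-mono-≤ (≤ᵇ-true⁻¹ {coord t i} hx) (≤ᵇ-true⁻¹ {coord t j} hy)))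

closed⇒carry : ∀ t → AdditivelyClosed (memK t) → CarryInequality t
closed⇒carry t closed {i} {j} ri rj =
  ≤ᵇ-true⁻¹ (trans (sym (memK-spec t _ (rem4-residue (i + j))))
                   (subst (λ n → memK t n ≡ true) (split-sum (coord t i) (coord t j) i j)
                          (closed (coord t i * 4 + i) (coord t j * 4 + j) (least-element ri) (least-element rj))))
  where
  least-element : ∀ {r} → Residue4 r → memK t (coord t r * 4 + r) ≡ true
  least-element {r} rr = trans (memK-spec t (coord t r) rr) (≤ᵇ-true (≤-refl {coord t r}))

record Kunz (t : Triple) : Set where
  field
    k₁≥1 : 1 ≤ k₁ t
    k₂≥1 : 1 ≤ k₂ t
    k₃≥1 : 1 ≤ k₃ t
    k₂≤k₁+k₁ : k₂ t ≤ k₁ t + k₁ t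
    k₂≤k₃+k₃+1 : k₂ t ≤ k₃ t + k₃ t + 1
    k₃≤k₁+k₂ : k₃ t ≤ k₁ t + k₂ t
    k₁≤k₂+k₃+1 : k₁ t ≤ k₂ t + k₃ t + 1

kunz⇒carry : ∀ {t} → Kunz t → CarryInequality t
kunz⇒carry {t} K = carry
  where
  open Kunz K
  carry : CarryInequality t
  carry r0 r0 = z≤n
  carry r0 r1 = m≤m+n _ 0
  carry r0 r2 = m≤m+n _ 0
  carry r0 r3 = m≤m+n _ 0
  carry r1 r0 = ≤-trans (m≤m+n _ 0) (m≤m+n _ 0)
  carry r2 r0 = ≤-trans (m≤m+n _ 0) (m≤m+n _ 0)
  carry r3 r0 = ≤-trans (m≤m+n _ 0) (m≤m+n _ 0)
  carry r1 r1 = ≤-trans k₂≤k₁+k₁ (m≤m+n _ 0)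
  carry r1 r2 = ≤-trans k₃≤k₁+k₂ (m≤m+n _ 0)
  carry r2 r1 = ≤-trans k₃≤k₁+k₂ (≤-trans (≤-reflexive (+-comm (k₁ t) (k₂ t))) (m≤m+n _ 0))
  carry r1 r3 = z≤n
  carry r3 r1 = z≤n
  carry r2 r2 = z≤n
  carry r2 r3 = k₁≤k₂+k₃+1
  carry r3 r2 = subst (λ s → k₁ t ≤ s + 1) (+-comm (k₂ t) (k₃ t)) k₁≤k₂+k₃+1
  carry r3 r3 = k₂≤k₃+k₃+1

closed⇒kunz : ∀ t → (∀ n → 0 < n → n < 4 → memK t n ≡ false) → AdditivelyClosed (memK t) → Kunz t
closed⇒kunz t small closed = record
  { k₁≥1 = ≤ᵇ-false⁻¹ (small 1 (s≤s z≤n) (s≤s (s≤s z≤n)))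
  ; k₂≥1 = ≤ᵇ-false⁻¹ (small 2 (s≤s z≤n) (s≤s (s≤s (s≤s z≤n))))
  ; k₃≥1 = ≤ᵇ-false⁻¹ (small 3 (s≤s z≤n) (s≤s (s≤s (s≤s (s≤s z≤n)))))
  ; k₂≤k₁+k₁ = ≤-trans (carry r1 r1) (≤-reflexive (+-identityʳ _))
  ; k₂≤k₃+k₃+1 = carry r3 r3
  ; k₃≤k₁+k₂ = ≤-trans (carry r1 r2) (≤-reflexive (+-identityʳ _))
  ; k₁≤k₂+k₃+1 = carry r2 r3
  }
  where
  carry : CarryInequality t
  carry = closed⇒carry t closed

kunz⇒small : ∀ {t} → Kunz t → ∀ n → 0 < n → n < 4 → memK t n ≡ false
kunz⇒small K 1 _ _ = ≤ᵇ-false (Kunz.k₁≥1 K)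
kunz⇒small K 2 _ _ = ≤ᵇ-false (Kunz.k₂≥1 K)
kunz⇒small K 3 _ _ = ≤ᵇ-false (Kunz.k₃≥1 K)
kunz⇒small K (suc (suc (suc (suc n)))) _ (s≤s (s≤s (s≤s (s≤s ()))))

memK-cofinite : ∀ t n → weight t * 4 ≤ n → memK t n ≡ true
memK-cofinite t n h = ≤ᵇ-true (≤-trans (coord≤weight t (rem4 n)) (quot4-lower (weight t) n h))

kunzSemigroup : ∀ t → Kunz t → NumericalSemigroup
kunzSemigroup t K = record
  { mem = memK t
  ; zero∈ = refl
  ; closed = carry⇒closed t (kunz⇒carry K)
  ; cofinite = weight t * 4 , memK-cofinite t
  }

kunz-multiplicity : ∀ t (K : Kunz t) → HasMultiplicity (kunzSemigroup t K) 4
kunz-multiplicity t K = s≤s z≤n , refl , kunz⇒small K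

classGaps : ℕ → ℕ → List ℕ
classGaps r k = applyUpTo (λ q → q * 4 + r) k

∈-classGaps⁻ : ∀ {r k n} → Residue4 r → n ∈ classGaps r k → rem4 n ≡ r × quot4 n < k
∈-classGaps⁻ {k = k} rr p with ∈-applyUpTo⁻ _ p
... | q , q<k , refl = rem4-unique q rr , subst (_< k) (sym (quot4-unique q rr)) q<k

∈-classGaps⁺ : ∀ {r k n} → rem4 n ≡ r → quot4 n < k → n ∈ classGaps r k
∈-classGaps⁺ {n = n} refl lt =
  subst (_∈ classGaps (rem4 n) _) (quot4-rem4 n) (∈-applyUpTo⁺ (λ q → q * 4 + rem4 n) lt)

classGaps-unique : ∀ r k → Unique (classGaps r k)
classGaps-unique r k = applyUpTo⁺₁ _ k λ i<j _ e → <⇒≢ i<j (*-cancelʳ-≡ _ _ 4 (+-cancelʳ-≡ r _ _ e))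

classGaps-disjoint : ∀ {r r′ k k′} → Residue4 r → Residue4 r′ → r ≢ r′ →
                     Disjoint (classGaps r k) (classGaps r′ k′)
classGaps-disjoint rr rr′ r≢r′ (p , p′) =
  r≢r′ (trans (sym (proj₁ (∈-classGaps⁻ rr p))) (proj₁ (∈-classGaps⁻ rr′ p′)))

gapList : Triple → List ℕ
gapList t = classGaps 1 (k₁ t) ++ (classGaps 2 (k₂ t) ++ classGaps 3 (k₃ t))

gapList-unique : ∀ t → Unique (gapList t)
gapList-unique t =
  ++⁺ (classGaps-unique 1 (k₁ t))
      (++⁺ (classGaps-unique 2 (k₂ t)) (classGaps-unique 3 (k₃ t)) (classGaps-disjoint r2 r3 λ ()))
      first-disjoint
  where
  first-disjoint : Disjoint (classGaps 1 (k₁ t)) (classGaps 2 (k₂ t) ++ classGaps 3 (k₃ t))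
  first-disjoint (p , p′) with ∈-++⁻ (classGaps 2 (k₂ t)) p′
  ... | inj₁ p₂ = classGaps-disjoint r1 r2 (λ ()) (p , p₂)
  ... | inj₂ p₃ = classGaps-disjoint r1 r3 (λ ()) (p , p₃)

gapList-length : ∀ t → length (gapList t) ≡ weight t
gapList-length t = begin
  length (gapList t)                                            ≡⟨ length-++ (classGaps 1 (k₁ t)) ⟩
  length (classGaps 1 (k₁ t)) + length (classGaps 2 (k₂ t) ++ classGaps 3 (k₃ t))
    ≡⟨ cong (length (classGaps 1 (k₁ t)) +_) (length-++ (classGaps 2 (k₂ t))) ⟩
  length (classGaps 1 (k₁ t)) + (length (classGaps 2 (k₂ t)) + length (classGaps 3 (k₃ t)))
    ≡⟨ cong₂ _+_ (length-applyUpTo _ (k₁ t)) (cong₂ _+_ (length-applyUpTo _ (k₂ t)) (length-applyUpTo _ (k₃ t))) ⟩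
  weight t                                                      ∎
  where open ≡-Reasoning

gapList-gaps : ∀ t n → (n ∈ gapList t) ⇔ (memK t n ≡ false)
gapList-gaps t n = mk⇔ to (λ h → from (rem4-residue n) refl (≤ᵇ-false⁻¹ h))
  where
  gap : ∀ {r} → Residue4 r → n ∈ classGaps r (coord t r) → memK t n ≡ false
  gap rr p with ∈-classGaps⁻ rr p
  ... | refl , lt = ≤ᵇ-false lt
  to : n ∈ gapList t → memK t n ≡ false
  to p with ∈-++⁻ (classGaps 1 (k₁ t)) p
  ... | inj₁ p₁ = gap r1 p₁
  ... | inj₂ p′ with ∈-++⁻ (classGaps 2 (k₂ t)) p′
  ...   | inj₁ p₂ = gap r2 p₂
  ...   | inj₂ p₃ = gap r3 p₃
  from : ∀ {r} → Residue4 r → rem4 n ≡ r → quot4 n < coord t r → n ∈ gapList t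
  from r0 _ ()
  from r1 e lt = ∈-++⁺ˡ (∈-classGaps⁺ e lt)
  from r2 e lt = ∈-++⁺ʳ (classGaps 1 (k₁ t)) (∈-++⁺ˡ (∈-classGaps⁺ e lt))
  from r3 e lt = ∈-++⁺ʳ (classGaps 1 (k₁ t)) (∈-++⁺ʳ (classGaps 2 (k₂ t)) (∈-classGaps⁺ e lt))

genus-weight : ∀ {S g t} → HasGenus S g → (∀ n → mem S n ≡ memK t n) → weight t ≡ g
genus-weight {S} {g} {t} (gs , unique , length≡g , gaps) agree =
  trans (sym (gapList-length t)) (trans (unique-length (gapList-unique t) unique same) length≡g)
  where
  same : ∀ {n} → (n ∈ gapList t) ⇔ (n ∈ gs)
  same {n} = mk⇔
    (λ p → Equivalence.from (gaps n) (trans (agree n) (Equivalence.to (gapList-gaps t n) p)))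
    (λ p → Equivalence.from (gapList-gaps t n) (trans (sym (agree n)) (Equivalence.to (gaps n) p)))

class-upward : ∀ S → mem S 4 ≡ true → ∀ i {k q} → k ≤′ q → mem S (k * 4 + i) ≡ true → mem S (q * 4 + i) ≡ true
class-upward S m4 i ≤′-refl h = h
class-upward S m4 i (≤′-step k≤q) h = closed S 4 _ m4 (class-upward S m4 i k≤q h)

class-threshold : ∀ S → mem S 4 ≡ true → ∀ i → ∃ λ k → ∀ q → mem S (q * 4 + i) ≡ (k ≤ᵇ q)
class-threshold S m4 i with cofinite S
... | N , above with least (λ q → mem S (q * 4 + i)) N (above _ (≤-trans (m≤m*n N 4) (m≤m+n _ i)))
...   | k , in-S , below = k , threshold
  where
  threshold : ∀ q → mem S (q * 4 + i) ≡ (k ≤ᵇ q)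
  threshold q with k ≤? q
  ... | yes k≤q = trans (class-upward S m4 i (≤⇒≤′ k≤q) in-S) (sym (≤ᵇ-true k≤q))
  ... | no k≰q = trans (below q (≰⇒> k≰q)) (sym (≤ᵇ-false (≰⇒> k≰q)))

record KunzCoordinates (S : NumericalSemigroup) : Set where
  field
    triple : Triple
    kunz : Kunz triple
    agree : ∀ n → mem S n ≡ memK triple n

kunzCoordinates : ∀ S → HasMultiplicity S 4 → KunzCoordinates S
kunzCoordinates S (_ , m4 , small) = record { triple = t ; kunz = kunz ; agree = agree }
  where
  threshold : ℕ → ℕ
  threshold i = proj₁ (class-threshold S m4 i)
  t : Triple
  t = ⟨ threshold 1 , threshold 2 , threshold 3 ⟩
  agree-class : ∀ {r} → Residue4 r → ∀ q → mem S (q * 4 + r) ≡ memK t (q * 4 + r)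
  agree-class r0 q = trans (class-upward S m4 0 {0} {q} (≤⇒≤′ z≤n) (zero∈ S)) (sym (memK-spec t q r0))
  agree-class r1 q = trans (proj₂ (class-threshold S m4 1) q) (sym (memK-spec t q r1))
  agree-class r2 q = trans (proj₂ (class-threshold S m4 2) q) (sym (memK-spec t q r2))
  agree-class r3 q = trans (proj₂ (class-threshold S m4 3) q) (sym (memK-spec t q r3))
  agree : ∀ n → mem S n ≡ memK t n
  agree n = subst (λ m → mem S m ≡ memK t m) (quot4-rem4 n) (agree-class (rem4-residue n) (quot4 n))
  kunz : Kunz t
  kunz = closed⇒kunz t
    (λ n 0<n n<4 → trans (sym (agree n)) (small n 0<n n<4))
    (λ x y hx hy → trans (sym (agree (x + y))) (closed S x y (trans (agree x) hx) (trans (agree y) hy)))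

φ : Triple → Triple
φ ⟨ a , b , c ⟩ = if a ≤ᵇ b + c then ⟨ suc a , b , c ⟩ else ⟨ suc c , b , a ⟩

φ-kunz : ∀ {t} → Kunz t → Kunz (φ t)
φ-kunz {⟨ a , b , c ⟩} K with a ≤ᵇ b + c in a≤b+c
... | true = record
  { k₁≥1 = s≤s z≤n
  ; k₂≥1 = k₂≥1
  ; k₃≥1 = k₃≥1
  ; k₂≤k₁+k₁ = ≤-trans k₂≤k₁+k₁ (+-mono-≤ (n≤1+n a) (n≤1+n a))
  ; k₂≤k₃+k₃+1 = k₂≤k₃+k₃+1
  ; k₃≤k₁+k₂ = ≤-trans k₃≤k₁+k₂ (n≤1+n _)
  ; k₁≤k₂+k₃+1 = ≤-trans (≤-reflexive (+-comm 1 a)) (+-monoˡ-≤ 1 (≤ᵇ-true⁻¹ a≤b+c))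
  }
  where open Kunz K
... | false = record
  { k₁≥1 = s≤s z≤n
  ; k₂≥1 = k₂≥1
  ; k₃≥1 = k₁≥1
  ; k₂≤k₁+k₁ = ≤-trans k₂≤k₃+k₃+1 (≤-trans (≤-reflexive (+-comm (c + c) 1)) (s≤s (+-monoʳ-≤ c (n≤1+n c))))
  ; k₂≤k₃+k₃+1 = ≤-trans k₂≤k₁+k₁ (m≤m+n _ 1)
  ; k₃≤k₁+k₂ = ≤-trans k₁≤k₂+k₃+1 (≤-reflexive (rotate b c))
  ; k₁≤k₂+k₃+1 = ≤-trans (s≤s k₃≤k₁+k₂) (≤-reflexive (sym (rotate b a)))
  }
  where
  open Kunz K
  rotate : ∀ x y → x + y + 1 ≡ suc (y + x)
  rotate = solve-∀

φ-weight : ∀ t → weight (φ t) ≡ suc (weight t)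
φ-weight ⟨ a , b , c ⟩ with a ≤ᵇ b + c
... | true = refl
... | false = cong suc (swap a b c)
  where
  swap : ∀ a b c → c + (b + a) ≡ a + (b + c)
  swap = solve-∀

-- The branches have disjoint images on Kunz triples: the second branch
-- would need k₃ > k₁ + k₂ in the preimage of the first.
φ-injective : ∀ {t t′} → Kunz t → Kunz t′ → φ t ≡ φ t′ → t ≡ t′
φ-injective {⟨ a , b , c ⟩} {⟨ a′ , b′ , c′ ⟩} K K′ eq
  with a ≤ᵇ b + c in e | a′ ≤ᵇ b′ + c′ in e′ | eq
... | true  | true  | refl = refl
... | false | false | refl = refl
... | true  | false | refl =
  ⊥-elim (<⇒≱ (≤ᵇ-false⁻¹ e′) (≤-trans (Kunz.k₃≤k₁+k₂ K) (≤-reflexive (+-comm c′ b′))))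
... | false | true  | refl =
  ⊥-elim (<⇒≱ (≤ᵇ-false⁻¹ e) (≤-trans (Kunz.k₃≤k₁+k₂ K′) (≤-reflexive (+-comm c b))))

module _ {g : ℕ} where

  coords : 𝒮 4 g → Triple
  coords (S , mult , _) = KunzCoordinates.triple (kunzCoordinates S mult)

  coords-kunz : ∀ x → Kunz (coords x)
  coords-kunz (S , mult , _) = KunzCoordinates.kunz (kunzCoordinates S mult)

  coords-agree : ∀ x n → mem (proj₁ x) n ≡ memK (coords x) n
  coords-agree (S , mult , _) = KunzCoordinates.agree (kunzCoordinates S mult)

  coords-weight : ∀ x → weight (coords x) ≡ g
  coords-weight x@(S , _ , genus) = genus-weight {S} genus (coords-agree x)

  ≈S⇒coords≡ : ∀ x y → x ≈S y → coords x ≡ coords y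
  ≈S⇒coords≡ x y x≈y = memK-injective λ n →
    trans (sym (coords-agree x n)) (trans (x≈y n) (coords-agree y n))

  coords≡⇒≈S : ∀ x y → coords x ≡ coords y → x ≈S y
  coords≡⇒≈S x y eq n =
    trans (coords-agree x n) (trans (cong (λ t → memK t n) eq) (sym (coords-agree y n)))

  fromKunz : ∀ t → Kunz t → weight t ≡ g → 𝒮 4 g
  fromKunz t K w≡g =
    kunzSemigroup t K , kunz-multiplicity t K ,
    gapList t , gapList-unique t , trans (gapList-length t) w≡g , gapList-gaps t

corollary3p6 : (g : ℕ) → #𝒮≤#𝒮 4 g 4 (suc g)
corollary3p6 g = Φ , respects , reflects
  where
  Φ : 𝒮 4 g → 𝒮 4 (suc g)
  Φ x = fromKunz (φ (coords x)) (φ-kunz (coords-kunz x))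
                 (trans (φ-weight (coords x)) (cong suc (coords-weight x)))
  respects : ∀ x y → x ≈S y → Φ x ≈S Φ y
  respects x y x≈y n = cong (λ t → memK (φ t) n) (≈S⇒coords≡ x y x≈y)
  reflects : ∀ x y → Φ x ≈S Φ y → x ≈S y
  reflects x y Φx≈Φy =
    coords≡⇒≈S x y (φ-injective (coords-kunz x) (coords-kunz y) (memK-injective Φx≈Φy))
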